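{- Let $1\le k\le n$ and let $X$ be a subset of $V(D_1)$ with $|X|=k$. Then for every integer $l \ge (n-k)(n-1)$ and every vertex $i$ with $1\le i\le n-1$, there exists a walk of length $l$ in $D_1$ from some vertex $x_0\in X$ to $i$.
   Context: $D_1$ is the digraph with vertex set $\{1,\dots,n\}$ and arcs $(i,i+1)$ for $1\le i\le n-1$, $(n,1)$ and $(n-1,1)$. A walk of length $m$ is a sequence of arcs $e_1,\dots,e_m$ such that the terminal vertex of $e_i$ is the initial vertex of $e_{i+1}$; for each vertex $u$ there is also the trivial walk of length $0$ from $u$ to $u$. -}

module Defs where

open import Data.Nat using (ℕ; zero; suc; _+_)
open import Data.Fin using (Fin; toℕ)
open import Data.Sum using (_⊎_)
open import Data.Product using (_×_)
open import Relation.Binary.PropositionalEquality using (_≡_)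

-- Vertices of D₁ on n vertices: Fin n, where  a : Fin n  represents the
-- paper's vertex  toℕ a + 1  ∈ {1,…,n}.
-- Paper's vertex number of a:
label : ∀ {n} → Fin n → ℕ
label a = suc (toℕ a)

data Arc (n : ℕ) (u v : Fin n) : Set where
  step  : label v ≡ suc (label u) → Arc n u v
  fromN : label u ≡ n → label v ≡ 1 → Arc n u v
  fromN-1 : suc (label u) ≡ n → label v ≡ 1 → Arc n u v

data Walk (n : ℕ) : Fin n → Fin n → ℕ → Set where
  trivial : ∀ {u} → Walk n u u zero
  _∷_ : ∀ {u v w m} → Arc n u v → Walk n v w m → Walk n u w (suc m)

-- Read walks backwards from i. The vertices with a walk of length t to i always contain a
-- cyclic interval of the n-cycle 1 → 2 → ⋯ → n → 1: stepping back shifts it down by one, and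
-- whenever it passes vertex 1 it gains a vertex, since 1 has the two in-neighbours n - 1 and n.
-- Starting from {i} with i ≤ n - 1, after t steps the interval is everything or has a size s
-- with t < s (n - 1). A k-set avoiding an interval of size s has k ≤ n - s, so once
-- t ≥ (n - k)(n - 1) the interval must meet X.
module Submission where

open import Defs
open import Data.Nat using (ℕ; zero; suc; _+_; _*_; _∸_; _≤_; _<_; z≤n; s≤s; _≤?_; _<?_; NonZero)
open import Data.Nat.Properties
open import Data.Nat.DivMod using (_%_; [m+n]%n≡m%n; m<n⇒m%n≡m; m≤n⇒[n∸m]%m≡n%m)
open import Data.Fin using (Fin; zero; suc; toℕ; fromℕ; inject₁)
open import Data.Fin.Properties using (toℕ<n; toℕ-injective; toℕ-fromℕ; toℕ-inject₁; any?)
open import Data.Fin.Relation.Unary.Top using (view; ‵fromℕ; ‵inject₁)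
open import Data.Fin.Subset using (Subset; ∣_∣; _∈_; inside; outside)
open import Data.Fin.Subset.Properties using (_∈?_)
open import Data.Vec.Base using (_∷_; []; here; there)
open import Data.Product using (Σ; _×_; _,_)
open import Data.Sum using (_⊎_; inj₁; inj₂)
open import Data.Empty using (⊥-elim)
open import Function using (_∘_)
open import Relation.Nullary using (Dec; yes; no; ¬_)
open import Relation.Nullary.Decidable using (_×-dec_; _⊎-dec_)
open import Relation.Unary using (Decidable)
open import Relation.Binary.PropositionalEquality using (_≡_; refl; sym; trans; cong; subst; subst₂; module ≡-Reasoning)

miss : {A : Set} → Dec A → ℕ
miss (yes _) = 0
miss (no _)  = 1

miss-cong : {A B : Set} → (A → B) → (B → A) → (a : Dec A) (b : Dec B) → miss a ≡ miss b
miss-cong f g (yes _) (yes _) = refl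
miss-cong f g (yes a) (no ¬b) = ⊥-elim (¬b (f a))
miss-cong f g (no ¬a) (yes b) = ⊥-elim (¬a (g b))
miss-cong f g (no _)  (no _)  = refl

module Misses {P : ℕ → Set} (P? : Decidable P) where

  misses : ℕ → ℕ → ℕ
  misses m zero      = 0
  misses m (suc len) = miss (P? m) + misses (suc m) len

  misses-+ : ∀ m a b → misses m (a + b) ≡ misses m a + misses (m + a) b
  misses-+ m zero b = cong (λ m′ → misses m′ b) (sym (+-identityʳ m))
  misses-+ m (suc a) b = begin
    μ + misses (suc m) (a + b)                     ≡⟨ cong (μ +_) (misses-+ (suc m) a b) ⟩
    μ + (misses (suc m) a + misses (suc m + a) b)  ≡⟨ sym (+-assoc μ _ _) ⟩
    μ + misses (suc m) a + misses (suc m + a) b    ≡⟨ cong (λ o → μ + misses (suc m) a + misses o b) (sym (+-suc m a)) ⟩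
    μ + misses (suc m) a + misses (m + suc a) b    ∎
    where
    open ≡-Reasoning
    μ = miss (P? m)

  misses≤len : ∀ m len → misses m len ≤ len
  misses≤len m zero      = z≤n
  misses≤len m (suc len) with P? m
  ... | yes _ = m≤n⇒m≤1+n (misses≤len (suc m) len)
  ... | no _  = s≤s (misses≤len (suc m) len)

  misses-all : ∀ m len → (∀ j → m ≤ j → j < m + len → P j) → misses m len ≡ 0
  misses-all m zero      all = refl
  misses-all m (suc len) all with P? m
  ... | yes _ = misses-all (suc m) len λ j m<j j<m+1+len →
                  all j (<⇒≤ m<j) (subst (j <_) (sym (+-suc m len)) j<m+1+len)
  ... | no ¬p = ⊥-elim (¬p (all m ≤-refl (m<m+n m (s≤s z≤n))))

  misses-slide : ∀ m len → (P m → P (m + len)) → (P (m + len) → P m) →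
                 misses m len ≡ misses (suc m) len
  misses-slide m len f g = +-cancelˡ-≡ (miss (P? m)) _ _ (begin
    miss (P? m) + misses m len          ≡⟨ +-comm (miss (P? m)) _ ⟩
    misses m len + miss (P? m)          ≡⟨ cong (misses m len +_) (miss-cong f g (P? m) (P? (m + len))) ⟩
    misses m len + miss (P? (m + len))  ≡⟨ cong (misses m len +_) (sym (+-identityʳ _)) ⟩
    misses m len + misses (m + len) 1   ≡⟨ sym (misses-+ m len 1) ⟩
    misses m (len + 1)                  ≡⟨ cong (misses m) (+-comm len 1) ⟩
    miss (P? m) + misses (suc m) len    ∎)
    where open ≡-Reasoning

  misses-periodic : ∀ len → (∀ j → P j → P (j + len)) → (∀ j → P (j + len) → P j) →
                    ∀ m → misses 0 len ≡ misses m len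
  misses-periodic len f g zero    = refl
  misses-periodic len f g (suc m) = trans (misses-periodic len f g m) (misses-slide m len (f m) (g m))

  avoid-tail : ∀ {n m b} {X : Subset n} → (∀ {x} → x ∈ b ∷ X → ¬ P (m + toℕ x)) →
               ∀ {x} → x ∈ X → ¬ P (suc m + toℕ x)
  avoid-tail {m = m} avoid x∈X = avoid (there x∈X) ∘ subst P (sym (+-suc m _))

  avoids⇒∣X∣≤misses : ∀ {n} m (X : Subset n) → (∀ {x} → x ∈ X → ¬ P (m + toℕ x)) → ∣ X ∣ ≤ misses m n
  avoids⇒∣X∣≤misses m []           avoid = z≤n
  avoids⇒∣X∣≤misses m (inside ∷ X) avoid with P? m
  ... | yes pm = ⊥-elim (avoid here (subst P (sym (+-identityʳ m)) pm))
  ... | no _   = s≤s (avoids⇒∣X∣≤misses (suc m) X (avoid-tail avoid))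
  avoids⇒∣X∣≤misses m (outside ∷ X) avoid =
    ≤-trans (avoids⇒∣X∣≤misses (suc m) X (avoid-tail avoid)) (m≤n+m _ (miss (P? m)))

-- For a < n and j < n this says j ∈ {a, a + 1, …, a + s - 1} taken modulo n.
CyclicInterval : ℕ → ℕ → ℕ → ℕ → Set
CyclicInterval n a s j = (a ≤ j × j < a + s) ⊎ j + n < a + s

cyclicInterval? : ∀ n a s → Decidable (CyclicInterval n a s)
cyclicInterval? n a s j = ((a ≤? j) ×-dec (j <? a + s)) ⊎-dec (j + n <? a + s)

-- Extending the interval n-periodically to all of ℕ, the n positions outside it in [0, n)
-- can be counted in the window [a, a + n) instead, where they form the block [a + s, a + n).
avoidsCyclicInterval⇒∣X∣≤n∸s : ∀ {n a s} .{{_ : NonZero n}} → a < n → s ≤ n → (X : Subset n) →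
                                (∀ {x} → x ∈ X → ¬ CyclicInterval n a s (toℕ x)) → ∣ X ∣ ≤ n ∸ s
avoidsCyclicInterval⇒∣X∣≤n∸s {n} {a} {s} a<n s≤n X avoid = begin
  ∣ X ∣                                ≤⟨ avoids⇒∣X∣≤misses 0 X avoid% ⟩
  misses 0 n                           ≡⟨ misses-periodic n periodic periodic⁻¹ a ⟩
  misses a n                           ≡⟨ cong (misses a) (sym (m+[n∸m]≡n s≤n)) ⟩
  misses a (s + (n ∸ s))               ≡⟨ misses-+ a s (n ∸ s) ⟩
  misses a s + misses (a + s) (n ∸ s)  ≡⟨ cong (_+ misses (a + s) (n ∸ s)) (misses-all a s linear⇒cyclic) ⟩
  misses (a + s) (n ∸ s)               ≤⟨ misses≤len (a + s) (n ∸ s) ⟩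
  n ∸ s                                ∎
  where
  open ≤-Reasoning
  I = CyclicInterval n a s
  open Misses (λ j → cyclicInterval? n a s (j % n))

  avoid% : ∀ {x} → x ∈ X → ¬ I (toℕ x % n)
  avoid% {x} x∈X = avoid x∈X ∘ subst I (m<n⇒m%n≡m (toℕ<n x))

  periodic : ∀ j → I (j % n) → I ((j + n) % n)
  periodic j = subst I (sym ([m+n]%n≡m%n j n))

  periodic⁻¹ : ∀ j → I ((j + n) % n) → I (j % n)
  periodic⁻¹ j = subst I ([m+n]%n≡m%n j n)

  linear⇒cyclic : ∀ j → a ≤ j → j < a + s → I (j % n)
  linear⇒cyclic j a≤j j<a+s with j <? n
  ... | yes j<n = subst I (sym (m<n⇒m%n≡m j<n)) (inj₁ (a≤j , j<a+s))
  ... | no j≮n  = subst I (sym j%n≡j∸n) (inj₂ (subst (_< a + s) (sym (m∸n+n≡m n≤j)) j<a+s))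
    where
    n≤j : n ≤ j
    n≤j = ≮⇒≥ j≮n
    j%n≡j∸n : j % n ≡ j ∸ n
    j%n≡j∸n = trans (sym (m≤n⇒[n∸m]%m≡n%m n≤j))
                    (m<n⇒m%n≡m (m<n+o⇒m∸n<o j n (<-≤-trans j<a+s (+-mono-≤ (<⇒≤ a<n) s≤n))))

cyclicInterval-suc : ∀ {n a s j} → CyclicInterval n a s j → CyclicInterval n (suc a) s (suc j)
cyclicInterval-suc (inj₁ (a≤j , j<a+s)) = inj₁ (s≤s a≤j , s≤s j<a+s)
cyclicInterval-suc (inj₂ j+n<a+s)       = inj₂ (s≤s j+n<a+s)

cyclicInterval-last : ∀ {m a s} → CyclicInterval (suc m) a s m → CyclicInterval (suc m) (suc a) s 0
cyclicInterval-last (inj₁ (_ , m<a+s))   = inj₂ (s≤s m<a+s)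
cyclicInterval-last {m} (inj₂ m+n<a+s)   = inj₂ (s≤s (≤-trans (m≤n+m (suc m) m) (<⇒≤ m+n<a+s)))

cyclicInterval-full : ∀ {n j} a → j < n → CyclicInterval n a n j
cyclicInterval-full {n} {j} a j<n with a ≤? j
... | yes a≤j = inj₁ (a≤j , <-≤-trans j<n (m≤n+m n a))
... | no a≰j  = inj₂ (+-monoˡ-< n (≰⇒> a≰j))

cyclicInterval-singleton : ∀ {n a j} → a < n → CyclicInterval n a 1 j → j ≡ a
cyclicInterval-singleton {a = a} {j} _ (inj₁ (a≤j , j<a+1)) =
  ≤-antisym (≤-pred (subst (suc j ≤_) (+-comm a 1) j<a+1)) a≤j
cyclicInterval-singleton {n} {a} {j} a<n (inj₂ j+n<a+1) =
  ⊥-elim (<⇒≱ j+n<a+1 (≤-trans (subst (_≤ n) (+-comm 1 a) a<n) (m≤n+m n j)))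

cyclicInterval-wrap : ∀ {p s j} → CyclicInterval (suc (suc p)) p (suc s) j → j < p → suc j < s
cyclicInterval-wrap (inj₁ (p≤j , _)) j<p = ⊥-elim (<⇒≱ j<p p≤j)
cyclicInterval-wrap {p} {s} {j} (inj₂ j+n<p+s+1) _ =
  ≤-pred (+-cancelʳ-< p (suc (suc j)) (suc s) (subst₂ _<_ j+n≡j+2+p (+-comm p (suc s)) j+n<p+s+1))
  where
  j+n≡j+2+p : j + suc (suc p) ≡ suc (suc j) + p
  j+n≡j+2+p = trans (+-comm j (suc (suc p))) (cong (2 +_) (+-comm p j))

forwardArc : ∀ {m} (y : Fin m) → Arc (suc m) (inject₁ y) (suc y)
forwardArc y = step (cong (2 +_) (sym (toℕ-inject₁ y)))

lastArc : ∀ m → Arc (suc m) (fromℕ m) zero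
lastArc m = fromN (cong suc (toℕ-fromℕ m)) refl

secondLastArc : ∀ m → Arc (suc (suc m)) (inject₁ (fromℕ m)) zero
secondLastArc m = fromN-1 (cong (2 +_) (trans (toℕ-inject₁ (fromℕ m)) (toℕ-fromℕ m))) refl

module BackwardReach (p : ℕ) (i : Fin (suc (suc p))) where

  n : ℕ
  n = suc (suc p)

  Reaches : ℕ → ℕ → ℕ → Set
  Reaches t a s = ∀ x → CyclicInterval n a s (toℕ x) → Walk n x i t

  reaches-start : Reaches 0 (toℕ i) 1
  reaches-start x x∈I =
    subst (λ y → Walk n y i 0) (sym (toℕ-injective (cyclicInterval-singleton (toℕ<n i) x∈I))) trivial

  reaches-shift : ∀ {t a s} → Reaches t (suc a) s → Reaches (suc t) a s
  reaches-shift {a = a} {s} r x x∈I with view x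
  ... | ‵fromℕ =
    lastArc (suc p) ∷ r zero (cyclicInterval-last (subst (CyclicInterval n a s) (toℕ-fromℕ (suc p)) x∈I))
  ... | ‵inject₁ y =
    forwardArc y ∷ r (suc y) (cyclicInterval-suc (subst (CyclicInterval n a s) (toℕ-inject₁ y) x∈I))

  reaches-everything : ∀ {t a} b → Reaches t a n → Reaches t b n
  reaches-everything {a = a} b r x _ = r x (cyclicInterval-full a (toℕ<n x))

  -- Vertex 0 has the two in-neighbours p and p + 1 (the paper's n - 1 and n).
  reaches-wrap : ∀ {t s} → 1 ≤ s → Reaches t 0 s → Reaches (suc t) p (suc s)
  reaches-wrap {s = s} 1≤s r x x∈I with view x
  ... | ‵fromℕ = lastArc (suc p) ∷ r zero (inj₁ (z≤n , 1≤s))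
  ... | ‵inject₁ y with view y
  ...   | ‵fromℕ     = secondLastArc p ∷ r zero (inj₁ (z≤n , 1≤s))
  ...   | ‵inject₁ z = forwardArc (inject₁ z) ∷ r (suc (inject₁ z)) (inj₁ (z≤n , z+1<s))
    where
    z+1<s : suc (toℕ (inject₁ z)) < s
    z+1<s = cyclicInterval-wrap (subst (CyclicInterval n p (suc s)) (toℕ-inject₁ (inject₁ z)) x∈I)
                                (subst (_< p) (sym (toℕ-inject₁ z)) (toℕ<n z))

  -- A step with start > 0 leaves t + start unchanged; passing 0 adds p + 1 to t + start
  -- and, since the size grows by one, also to the bound size * (n - 1).
  record Frontier (t : ℕ) : Set where
    constructor frontier
    field
      start size : ℕ
      start<n    : start < n
      1≤size     : 1 ≤ size
      reaches    : Reaches t start size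
      progress   : size ≡ n ⊎ (size < n × t + start < size * suc p)

  open Frontier using (start; size; start<n; reaches)

  frontier-size≤n : ∀ {t} (F : Frontier t) → size F ≤ n
  frontier-size≤n (frontier _ _ _ _ _ (inj₁ refl))      = ≤-refl
  frontier-size≤n (frontier _ _ _ _ _ (inj₂ (s<n , _))) = <⇒≤ s<n

  frontier-next : ∀ {t} → Frontier t → Frontier (suc t)
  frontier-next (frontier a s a<n 1≤s r (inj₁ refl)) =
    frontier a n a<n 1≤s (reaches-shift (reaches-everything (suc a) r)) (inj₁ refl)
  frontier-next {t} (frontier (suc a) s a<n 1≤s r (inj₂ (s<n , t+a+1<sp))) =
    frontier a s (<-trans (n<1+n a) a<n) 1≤s (reaches-shift r)
             (inj₂ (s<n , subst (_< s * suc p) (+-suc t a) t+a+1<sp))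
  frontier-next {t} (frontier zero s a<n 1≤s r (inj₂ (s<n , t+0<sp))) =
    frontier p (suc s) (m≤n⇒m≤1+n (n<1+n p)) (s≤s z≤n) (reaches-wrap 1≤s r) progress
    where
    t+1+p<[s+1]p : suc t + p < suc s * suc p
    t+1+p<[s+1]p = s≤s (subst (suc t + p ≤_) (+-comm (s * suc p) p)
                     (+-monoˡ-≤ p (subst (_< s * suc p) (+-identityʳ t) t+0<sp)))
    progress : suc s ≡ n ⊎ (suc s < n × suc t + p < suc s * suc p)
    progress with m≤n⇒m<n∨m≡n s<n
    ... | inj₁ s+1<n = inj₂ (s+1<n , t+1+p<[s+1]p)
    ... | inj₂ s+1≡n = inj₁ s+1≡n

  frontier-at : toℕ i < suc p → ∀ t → Frontier t
  frontier-at i<p+1 zero    = frontier (toℕ i) 1 (toℕ<n i) ≤-refl reaches-start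
                                (inj₂ (s≤s (s≤s z≤n) , subst (toℕ i <_) (sym (+-identityʳ (suc p))) i<p+1))
  frontier-at i<p+1 (suc t) = frontier-next (frontier-at i<p+1 t)

  frontier-bound : ∀ {t k} (F : Frontier t) → 1 ≤ k → k ≤ n ∸ size F → t < (n ∸ k) * suc p
  frontier-bound {k = k} (frontier _ _ _ _ _ (inj₁ refl)) 1≤k k≤n∸n =
    ⊥-elim (<⇒≱ 1≤k (subst (k ≤_) (n∸n≡0 n) k≤n∸n))
  frontier-bound {t} {k} (frontier a s _ _ _ (inj₂ (s<n , t+a<sp))) _ k≤n∸s = begin-strict
    t                ≤⟨ m≤m+n t a ⟩
    t + a            <⟨ t+a<sp ⟩
    s * suc p        ≤⟨ *-monoˡ-≤ (suc p) s≤n∸k ⟩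
    (n ∸ k) * suc p  ∎
    where
    open ≤-Reasoning
    s≤n∸k : s ≤ n ∸ k
    s≤n∸k = m+n≤o⇒m≤o∸n s (subst (_≤ n) (+-comm k s) (m≤o∸n⇒m+n≤o k (<⇒≤ s<n) k≤n∸s))

  frontier-meets : ∀ {t} → Frontier t → (X : Subset n) → 1 ≤ ∣ X ∣ → (n ∸ ∣ X ∣) * suc p ≤ t →
                   Σ (Fin n) (λ x₀ → x₀ ∈ X × Walk n x₀ i t)
  frontier-meets F X 1≤∣X∣ bound with any? (λ x → (x ∈? X) ×-dec cyclicInterval? n (start F) (size F) (toℕ x))
  ... | yes (x₀ , x₀∈X , x₀∈I) = x₀ , x₀∈X , reaches F x₀ x₀∈I
  ... | no ¬meets = ⊥-elim (<⇒≱ (frontier-bound F 1≤∣X∣ ∣X∣≤n∸s) bound)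
    where
    ∣X∣≤n∸s : ∣ X ∣ ≤ n ∸ size F
    ∣X∣≤n∸s = avoidsCyclicInterval⇒∣X∣≤n∸s (start<n F) (frontier-size≤n F) X
                (λ x∈X x∈I → ¬meets (_ , x∈X , x∈I))

lemma3p1 : (n k : ℕ) → 1 ≤ k → k ≤ n → (X : Subset n) → ∣ X ∣ ≡ k →
    (l : ℕ) → (n ∸ k) * (n ∸ 1) ≤ l →
    (i : Fin n) → label i ≤ n ∸ 1 →
    Σ (Fin n) (λ x₀ → x₀ ∈ X × Walk n x₀ i l)
lemma3p1 zero          (suc _) _   () _ _    _ _  _ _
lemma3p1 (suc zero)    _       _   _  _ _    _ _  _ ()
lemma3p1 (suc (suc p)) _       1≤k _  X refl l l≥ i i<n-1 =
  frontier-meets (frontier-at i<n-1 l) X 1≤k l≥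
  where open BackwardReach p i
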